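{- Let $h\colon[n]\to[n]$ be a Hessenberg function and $w\in\mathfrak S_n$ a generator for $h$ that avoids the associated patterns $[1243]_h$, $[2134]_h$ and $[1423]_h$. Then $w$ contains the associated pattern $[2413]_h$ if and only if $w$ contains the associated pattern $[25314]_h$.
   Context: A Hessenberg function is a nondecreasing $h\colon[n]\to[n]$ with $h(i)\ge i$. Permutations are in one-line notation. A generator for $h$ is a $w$ with $w^{ -1}(w(i)+1)\le h(i)$ whenever $w(i)\le n-1$. Associated patterns: $w$ contains $[1243]_h$ if $w(i)<w(j)<w(\ell)<w(k)$ for some $i<j<k<\ell\le h(j)$ with $j\le h(i)<\ell$; $[2134]_h$ if $w(j)<w(i)<w(k)<w(\ell)$ for some $i<j<k<\ell\le h(k)$ with $k\le h(i)<\ell$; $[1423]_h$ if $w(i)<w(k)<w(\ell)<w(j)$ for some $i<j<k<\ell\le h(j)$ with $k\le h(i)<\ell$; $[2413]_h$ if $w(k)<w(i)<w(\ell)<w(j)$ for some $i<j\le h(i)<k\le h(j)<\ell\le h(k)$; $[25314]_h$ if $w(\ell)<w(i)<w(k)<w(m)<w(j)$ for some $i<j<k\le h(i)<\ell\le h(j)<m\le h(k)$. -}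

module Defs where

open import Data.Nat using (ℕ; suc)
open import Data.Fin using (Fin; toℕ; _≤_; _<_)
open import Data.Fin.Permutation using (Permutation′; _⟨$⟩ʳ_; _⟨$⟩ˡ_)
open import Data.Product using (Σ; _×_; ∃-syntax)
open import Relation.Binary.PropositionalEquality using (_≡_)

-- Positions and values are 0-based elements of Fin n (the paper uses [n] = {1..n});
-- all conditions only involve comparisons, so the shift is harmless.

record IsHessenberg (n : ℕ) (h : Fin n → Fin n) : Set where
  field
    monotone  : ∀ (i j : Fin n) → i ≤ j → h i ≤ h j
    extensive : ∀ (i : Fin n) → i ≤ h i

IsGenerator : (n : ℕ) → (h : Fin n → Fin n) → Permutation′ n → Set
IsGenerator n h w =
  ∀ (i v : Fin n) → toℕ v ≡ suc (toℕ (w ⟨$⟩ʳ i)) → (w ⟨$⟩ˡ v) ≤ h i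

Contains1243 : (n : ℕ) → (h : Fin n → Fin n) → Permutation′ n → Set
Contains1243 n h w = ∃[ i ] ∃[ j ] ∃[ k ] ∃[ l ]
  ( (i < j) × (j < k) × (k < l) × (l ≤ h j) × (j ≤ h i) × (h i < l)
  × (w ⟨$⟩ʳ i < w ⟨$⟩ʳ j) × (w ⟨$⟩ʳ j < w ⟨$⟩ʳ l) × (w ⟨$⟩ʳ l < w ⟨$⟩ʳ k) )

Contains2134 : (n : ℕ) → (h : Fin n → Fin n) → Permutation′ n → Set
Contains2134 n h w = ∃[ i ] ∃[ j ] ∃[ k ] ∃[ l ]
  ( (i < j) × (j < k) × (k < l) × (l ≤ h k) × (k ≤ h i) × (h i < l)
  × (w ⟨$⟩ʳ j < w ⟨$⟩ʳ i) × (w ⟨$⟩ʳ i < w ⟨$⟩ʳ k) × (w ⟨$⟩ʳ k < w ⟨$⟩ʳ l) )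

Contains1423 : (n : ℕ) → (h : Fin n → Fin n) → Permutation′ n → Set
Contains1423 n h w = ∃[ i ] ∃[ j ] ∃[ k ] ∃[ l ]
  ( (i < j) × (j < k) × (k < l) × (l ≤ h j) × (k ≤ h i) × (h i < l)
  × (w ⟨$⟩ʳ i < w ⟨$⟩ʳ k) × (w ⟨$⟩ʳ k < w ⟨$⟩ʳ l) × (w ⟨$⟩ʳ l < w ⟨$⟩ʳ j) )

Contains2413 : (n : ℕ) → (h : Fin n → Fin n) → Permutation′ n → Set
Contains2413 n h w = ∃[ i ] ∃[ j ] ∃[ k ] ∃[ l ]
  ( (i < j) × (j ≤ h i) × (h i < k) × (k ≤ h j) × (h j < l) × (l ≤ h k)
  × (w ⟨$⟩ʳ k < w ⟨$⟩ʳ i) × (w ⟨$⟩ʳ i < w ⟨$⟩ʳ l) × (w ⟨$⟩ʳ l < w ⟨$⟩ʳ j) )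

Contains25314 : (n : ℕ) → (h : Fin n → Fin n) → Permutation′ n → Set
Contains25314 n h w = ∃[ i ] ∃[ j ] ∃[ k ] ∃[ l ] ∃[ m ]
  ( (i < j) × (j < k) × (k ≤ h i) × (h i < l) × (l ≤ h j) × (h j < m) × (m ≤ h k)
  × (w ⟨$⟩ʳ l < w ⟨$⟩ʳ i) × (w ⟨$⟩ʳ i < w ⟨$⟩ʳ k) × (w ⟨$⟩ʳ k < w ⟨$⟩ʳ m)
  × (w ⟨$⟩ʳ m < w ⟨$⟩ʳ j) )

-- Put H = h(i) for a [2413]_h occurrence (i, j, k, ℓ). Climbing the values from w(i) to w(ℓ),
-- whose positions i ≤ H < ℓ lie on either side of H, some consecutive values v, v+1 sit at
-- positions p ≤ H < q, and the generator condition gives q ≤ h(p). Avoiding [1243]_h forces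
-- p > j, avoiding [1423]_h then forces q > h(j), and avoiding [2134]_h forces ℓ ≤ h(p); at that
-- point (i, j, p, k, ℓ) is an occurrence of [25314]_h. The converse simply forgets the entry k.
module Submission where

open import Defs
open import Data.Nat as ℕ using (ℕ; zero; suc; z≤n)
open import Data.Nat.Properties
  using (≤-reflexive; ≤-trans; <⇒≤; <-trans; ≤-<-trans; <-≤-trans; <-asym; <⇒≱; ≰⇒>; ≮⇒≥;
         n<1+n; m<n⇒m<1+n; m≤n⇒m<n∨m≡n)
open import Data.Fin using (Fin; toℕ; fromℕ<; _≤_; _<_)
open import Data.Fin.Properties as Fin using (toℕ<n; toℕ-fromℕ<)
open import Data.Fin.Permutation using (Permutation′; _⟨$⟩ʳ_; _⟨$⟩ˡ_; inverseˡ; inverseʳ)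
open import Data.Product using (_×_; _,_; ∃; ∃₂; ∃-syntax)
open import Data.Sum using (inj₁; inj₂)
open import Function.Base using (_∘_)
open import Function.Bundles using (Injection)
open import Function.Properties.Inverse using (↔⇒↣)
open import Relation.Binary using (tri<; tri≈; tri>)
open import Relation.Binary.PropositionalEquality using (_≡_; refl; sym; trans; cong; subst)
open import Relation.Nullary using (¬_; yes; no)
open import Relation.Nullary.Decidable using (_×-dec_)
open import Relation.Nullary.Negation using (contradiction)
open import Relation.Unary using (Pred; Decidable)

crossing : ∀ {p} {P : Pred ℕ p} → Decidable P → ∀ {a b} → a ℕ.≤ b → P a → ¬ P b →
           ∃[ c ] a ℕ.≤ c × c ℕ.< b × P c × ¬ P (suc c)
crossing P? {b = zero} z≤n Pa ¬Pb = contradiction Pa ¬Pb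
crossing P? {a} {suc b} a≤1+b Pa ¬P1+b with m≤n⇒m<n∨m≡n a≤1+b | P? b
... | inj₂ refl      | _      = contradiction Pa ¬P1+b
... | inj₁ a<1+b     | yes Pb = b , ℕ.s≤s⁻¹ a<1+b , n<1+n b , Pb , ¬P1+b
... | inj₁ a<1+b     | no ¬Pb with crossing P? (ℕ.s≤s⁻¹ a<1+b) Pa ¬Pb
...   | c , a≤c , c<b , Pc , ¬P1+c = c , a≤c , m<n⇒m<1+n c<b , Pc , ¬P1+c

module _ {n : ℕ} (π : Permutation′ n) where

  ⟨$⟩ʳ-injective : ∀ {x y} → π ⟨$⟩ʳ x ≡ π ⟨$⟩ʳ y → x ≡ y
  ⟨$⟩ʳ-injective = Injection.injective (↔⇒↣ π)

  consecutive-crossing : ∀ {s} {S : Pred (Fin n) s} → Decidable S →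
    ∀ {a b} → S a → ¬ S b → π ⟨$⟩ʳ a ≤ π ⟨$⟩ʳ b →
    ∃₂ λ p q → S p × ¬ S q × toℕ (π ⟨$⟩ʳ q) ≡ suc (toℕ (π ⟨$⟩ʳ p))
             × π ⟨$⟩ʳ a ≤ π ⟨$⟩ʳ p × π ⟨$⟩ʳ q ≤ π ⟨$⟩ʳ b
  consecutive-crossing {S = S} S? {a} {b} Sa ¬Sb πa≤πb
    with crossing P? πa≤πb (a , refl , Sa)
                  (λ (x , πx≡πb , Sx) → ¬Sb (subst S (⟨$⟩ʳ-injective (Fin.toℕ-injective πx≡πb)) Sx))
    where
    P : Pred ℕ _
    P v = ∃ λ x → toℕ (π ⟨$⟩ʳ x) ≡ v × S x
    P? : Decidable P
    P? v = Fin.any? λ x → (toℕ (π ⟨$⟩ʳ x) ℕ.≟ v) ×-dec S? x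
  ... | c , πa≤c , c<πb , (p , refl , Sp) , ¬P1+c =
    p , q , Sp , (λ Sq → ¬P1+c (q , πq≡1+c , Sq)) , πq≡1+c , πa≤c ,
    subst (ℕ._≤ toℕ (π ⟨$⟩ʳ b)) (sym πq≡1+c) c<πb
    where
    1+c<n : suc c ℕ.< n
    1+c<n = ≤-<-trans c<πb (toℕ<n (π ⟨$⟩ʳ b))
    q : Fin n
    q = π ⟨$⟩ˡ fromℕ< 1+c<n
    πq≡1+c : toℕ (π ⟨$⟩ʳ q) ≡ suc c
    πq≡1+c = trans (cong toℕ (inverseʳ π)) (toℕ-fromℕ< 1+c<n)

module _ {n : ℕ} {h : Fin n → Fin n} (hessenberg : IsHessenberg n h) where

  open IsHessenberg hessenberg

  contains25314⇒contains2413 : ∀ {w} → Contains25314 n h w → Contains2413 n h w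
  contains25314⇒contains2413
    (i , j , k , l , m , i<j , j<k , k≤hi , hi<l , l≤hj , hj<m , m≤hk , wl<wi , wi<wk , wk<wm , wm<wj) =
    i , j , l , m , i<j , <⇒≤ (<-≤-trans j<k k≤hi) , hi<l , l≤hj , hj<m ,
    ≤-trans m≤hk (monotone k l (<⇒≤ (≤-<-trans k≤hi hi<l))) , wl<wi , <-trans wi<wk wk<wm , wm<wj

  module _ {w : Permutation′ n} (generator : IsGenerator n h w) where

    generator-successor : ∀ {p q} → toℕ (w ⟨$⟩ʳ q) ≡ suc (toℕ (w ⟨$⟩ʳ p)) → q ≤ h p
    generator-successor {p} eq = subst (_≤ h p) (inverseˡ w) (generator p _ eq)

    escape : ∀ {i l} → h i < l → w ⟨$⟩ʳ i ≤ w ⟨$⟩ʳ l →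
      ∃₂ λ p q → i < p × p ≤ h i × h i < q × q ≤ h p × toℕ (w ⟨$⟩ʳ q) ≡ suc (toℕ (w ⟨$⟩ʳ p))
               × w ⟨$⟩ʳ i < w ⟨$⟩ʳ p × w ⟨$⟩ʳ q ≤ w ⟨$⟩ʳ l
    escape {i} hi<l wi≤wl
      with consecutive-crossing w (Fin._≤? h i) (extensive i) (<⇒≱ hi<l) wi≤wl
    ... | p , q , p≤hi , q≰hi , wq≡1+wp , wi≤wp , wq≤wl =
      p , q , i<p , p≤hi , ≰⇒> q≰hi , q≤hp , wq≡1+wp ,
      Fin.≤∧≢⇒< wi≤wp (Fin.<⇒≢ i<p ∘ ⟨$⟩ʳ-injective w) , wq≤wl
      where
      q≤hp : q ≤ h p
      q≤hp = generator-successor wq≡1+wp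
      i<p : i < p
      i<p = ≰⇒> λ p≤i → q≰hi (≤-trans q≤hp (monotone p i p≤i))

    module _ (avoids1243 : ¬ Contains1243 n h w) (avoids1423 : ¬ Contains1423 n h w)
             (avoids2134 : ¬ Contains2134 n h w) where

      contains2413⇒contains25314 : Contains2413 n h w → Contains25314 n h w
      contains2413⇒contains25314
        (i , j , k , l , i<j , j≤hi , hi<k , k≤hj , hj<l , l≤hk , wk<wi , wi<wl , wl<wj)
        with escape (<-≤-trans hi<k (≤-trans k≤hj (<⇒≤ hj<l))) (<⇒≤ wi<wl)
      ... | p , q , i<p , p≤hi , hi<q , q≤hp , wq≡1+wp , wi<wp , wq≤wl =
        i , j , p , k , l , i<j , j<p , p≤hi , hi<k , k≤hj , hj<l , l≤hp , wk<wi , wi<wp , wp<wl , wl<wj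
        where
        wp<wq : w ⟨$⟩ʳ p < w ⟨$⟩ʳ q
        wp<wq = ≤-reflexive (sym wq≡1+wp)
        wp<wl : w ⟨$⟩ʳ p < w ⟨$⟩ʳ l
        wp<wl = <-≤-trans wp<wq wq≤wl
        wq<wj : w ⟨$⟩ʳ q < w ⟨$⟩ʳ j
        wq<wj = ≤-<-trans wq≤wl wl<wj
        j<p : j < p
        j<p with Fin.<-cmp p j
        ... | tri< p<j _ _ = contradiction
                (i , p , j , q , i<p , p<j , ≤-<-trans j≤hi hi<q , q≤hp , p≤hi , hi<q , wi<wp , wp<wq , wq<wj)
                avoids1243
        ... | tri≈ _ refl _ = contradiction wl<wj (<-asym wp<wl)
        ... | tri> _ _ j<p = j<p
        hj<q : h j < q
        hj<q = ≰⇒> λ q≤hj → avoids1423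
          (i , j , p , q , i<j , j<p , ≤-<-trans p≤hi hi<q , q≤hj , p≤hi , hi<q , wi<wp , wp<wq , wq<wj)
        l≤hp : l ≤ h p
        l≤hp = ≮⇒≥ λ hp<l →
          let k<q = ≤-<-trans k≤hj hj<q
              q<l = ≤-<-trans q≤hp hp<l
              wq<wl = Fin.≤∧≢⇒< wq≤wl (Fin.<⇒≢ q<l ∘ ⟨$⟩ʳ-injective w)
          in avoids2134 (p , k , q , l , ≤-<-trans p≤hi hi<k , k<q , q<l ,
                         ≤-trans l≤hk (monotone k q (<⇒≤ k<q)) , q≤hp , hp<l ,
                         <-trans wk<wi wi<wp , wp<wq , wq<wl)

lemma4p11 : (n : ℕ) (h : Fin n → Fin n) (w : Permutation′ n) → IsHessenberg n h → IsGenerator n h w → ¬ Contains1243 n h w → ¬ Contains2134 n h w → ¬ Contains1423 n h w → ((Contains2413 n h w → Contains25314 n h w) × (Contains25314 n h w → Contains2413 n h w))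
lemma4p11 n h w hessenberg generator avoids1243 avoids2134 avoids1423 =
  contains2413⇒contains25314 hessenberg {w} generator avoids1243 avoids1423 avoids2134 ,
  contains25314⇒contains2413 hessenberg {w}
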